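{- Let $\sigma,\pi\in G_{r,n}$ and $I\subseteq[n]$. Then $\sigma\in\mathcal{CL}(C(I,\pi))$ if and only if $\mathrm{Des}(\sigma^{ -1}\pi)\subseteq I$.
   Context: Fix integers $r\ge1$, $n\ge1$, $[n]=\{1,\dots,n\}$. For a totally ordered set $Y$, $Y_{(r)}=\{0,\dots,r-1\}\times Y$ ordered lexicographically; write $x_k$ for $(k,x)$, $|x_k|=x$, $\epsilon(x_k)=k$; colors read mod $r$. $G_{r,n}$ is the group under composition of bijections $\pi$ of $[n]_{(r)}$ with $\pi(i_j)=k_l\Rightarrow\pi(i_{j+a})=k_{l+a}$ (mod $r$); one-line notation $\pi(1)\cdots\pi(n)$, $\pi(i)=\pi(i_0)$; product: if $\pi(i)=j_k$, $\sigma(j)=l_p$ then $(\sigma\pi)(i)=l_{k+p}$. $\mathrm{Des}(\pi)=\{i\in[n]:\pi(i)>\pi(i+1)\}$ in $[0,n]_{(r)}$ with $\pi(n+1)=0_1$. An $r$-colored poset is a set $P=\{0_1,\dots,0_{r-1}\}\cup Q$, $Q\subseteq[n]_{(r)}$ with distinct absolute values, with a partial order $\prec$ such that $0_1\prec\cdots\prec0_{r-1}$. $G^0_{r,n}$ is the set of shuffles of the one-line word of some $\pi\in G_{r,n}$ with $0_10_2\cdots0_{r-1}$. For $w\in G^0_{r,n}$ the $0$-letters split $w$ into $r$ (possibly empty) subwords numbered $0,\dots,r-1$ left to right; $\pi_i$ is subword $i$ with $i$ subtracted (mod $r$) from each color; $\mathcal{CL}(w)$ is the set of shuffles of $\pi_0,\dots,\pi_{r-1}$.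 For $P$ with one element of each absolute value $1,\dots,n$, $\mathcal{L}(P)$ is the set of $w\in G^0_{r,n}$ with letters the elements of $P$ such that $x\prec y$ implies $x$ left of $y$ in $w$, and $\mathcal{CL}(P)=\bigcup_{w\in\mathcal{L}(P)}\mathcal{CL}(w)$. The colored chain poset $C(I,\pi)$ is the $r$-colored poset on $\{\pi(1),\dots,\pi(n),0_1,\dots,0_{r-1}\}$ whose order is generated by $0_1\prec\cdots\prec0_{r-1}$ and, for each $i\in[n]\setminus I$ (with $\pi(n+1)=0_1$), $\pi(i)\prec\pi(i+1)$. -}

module Defs where

open import Data.Nat using (ℕ; zero; suc; _∸_; _<_; _<?_; NonZero) renaming (_+_ to _+ℕ_)
open import Data.Nat.DivMod using (_mod_)
open import Data.Fin using (Fin; toℕ; fromℕ<)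
open import Data.Fin.Subset using (Subset; _∈_)
open import Data.Fin.Permutation using (Permutation′; _⟨$⟩ʳ_; _⟨$⟩ˡ_; _∘ₚ_; flip)
open import Data.Product using (_×_; _,_; proj₁; proj₂; ∃; ∃-syntax)
open import Data.Sum using (_⊎_)
open import Data.List using (List; []; _∷_; _++_; map; allFin; drop)
open import Data.List.Relation.Binary.Permutation.Propositional using (_↭_)
import Data.List.Relation.Ternary.Interleaving.Propositional as IL
open import Relation.Binary.PropositionalEquality using (_≡_)
open import Relation.Binary.Construct.Closure.Transitive using (TransClosure)
open import Relation.Nullary using (¬_; yes; no)

-- Colours are elements of Fin r (i.e. read mod r).  Letters of
-- [0,n]_(r) are pairs (colour , absolute value), value 0 = the 0-letters.

Colour : ℕ → Set
Colour r = Fin r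

Letter : ℕ → Set
Letter r = Colour r × ℕ

addC : ∀ {r} .{{_ : NonZero r}} → Colour r → Colour r → Colour r
addC {r} a b = (toℕ a +ℕ toℕ b) mod r

negC : ∀ {r} .{{_ : NonZero r}} → Colour r → Colour r
negC {r} a = (r ∸ toℕ a) mod r

subC : ∀ {r} .{{_ : NonZero r}} → Colour r → ℕ → Colour r
subC {r} a i = (toℕ a +ℕ (r ∸ (i mod' r))) mod r
  where
  _mod'_ : ℕ → (m : ℕ) → .{{_ : NonZero m}} → ℕ
  x mod' m = toℕ (x mod m)

zeroL : ∀ {r} .{{_ : NonZero r}} → ℕ → Letter r
zeroL {r} k = (k mod r , 0)

_<L_ : ∀ {r} → Letter r → Letter r → Set
(k , x) <L (l , y) = (toℕ k < toℕ l) ⊎ ((k ≡ l) × (x < y))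

-- An element is determined by
-- its one-line notation π(1)…π(n): a colour for each position and a
-- permutation of absolute values.  Position i : Fin n stands for i+1,
-- and the absolute value j : Fin n stands for j+1.

record ColPerm (r n : ℕ) : Set where
  constructor colPerm
  field
    colour : Fin n → Colour r
    perm   : Permutation′ n
open ColPerm public

letter : ∀ {r n} → ColPerm r n → Fin n → Letter r
letter π i = (colour π i , suc (toℕ (perm π ⟨$⟩ʳ i)))

-- product σπ : if π(i) = j_k and σ(j) = l_p then (σπ)(i) = l_{k+p}
_·_ : ∀ {r n} .{{_ : NonZero r}} → ColPerm r n → ColPerm r n → ColPerm r n
σ · π = colPerm (λ i → addC (colour π i) (colour σ (perm π ⟨$⟩ʳ i)))
                (perm π ∘ₚ perm σ)

-- inverse: if π(i) = j_k then π⁻¹(j) = i_{-k}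
inv : ∀ {r n} .{{_ : NonZero r}} → ColPerm r n → ColPerm r n
inv π = colPerm (λ j → negC (colour π (perm π ⟨$⟩ˡ j))) (flip (perm π))

oneLine : ∀ {r n} → ColPerm r n → List (Letter r)
oneLine {n = n} π = map (letter π) (allFin n)

-- Descents.  π(n+1) = 0_1.

nextLetter : ∀ {r n} .{{_ : NonZero r}} → ColPerm r n → Fin n → Letter r
nextLetter {n = n} π i with suc (toℕ i) <? n
... | yes p = letter π (fromℕ< p)
... | no _  = zeroL 1

IsDes : ∀ {r n} .{{_ : NonZero r}} → ColPerm r n → Fin n → Set
IsDes π i = nextLetter π i <L letter π i

DesSubset : ∀ {r n} .{{_ : NonZero r}} → ColPerm r n → Subset n → Set
DesSubset {n = n} π I = (i : Fin n) → IsDes π i → i ∈ I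

zeroWord : ∀ r → List (Letter r)
zeroWord r = map (λ k → (k , 0)) (drop 1 (allFin r))

ShuffleOf : ∀ {A : Set} → List (List A) → List A → Set
ShuffleOf []       w = w ≡ []
ShuffleOf (u ∷ us) w = ∃[ v ] (ShuffleOf us v × IL.Interleaving u v w)

InG0 : ∀ r n → List (Letter r) → Set
InG0 r n w = ∃[ π ] IL.Interleaving (oneLine {r} {n} π) (zeroWord r) w

private
  consHead : ∀ {A : Set} → A → List (List A) → List (List A)
  consHead x []       = (x ∷ []) ∷ []
  consHead x (u ∷ us) = (x ∷ u) ∷ us

splitZeros : ∀ {r} → List (Letter r) → List (List (Letter r))
splitZeros []             = [] ∷ []
splitZeros ((k , zero) ∷ w)  = [] ∷ splitZeros w
splitZeros ((k , suc x) ∷ w) = consHead (k , suc x) (splitZeros w)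

shiftFrom : ∀ {r} .{{_ : NonZero r}} → ℕ → List (List (Letter r)) → List (List (Letter r))
shiftFrom i []       = []
shiftFrom i (u ∷ us) = map (λ { (k , x) → (subC k i , x) }) u ∷ shiftFrom (suc i) us

pis : ∀ {r} .{{_ : NonZero r}} → List (Letter r) → List (List (Letter r))
pis w = shiftFrom 0 (splitZeros w)

InCLw : ∀ {r} .{{_ : NonZero r}} → List (Letter r) → List (Letter r) → Set
InCLw w u = ShuffleOf (pis w) u

record ColPoset (r : ℕ) : Set₁ where
  field
    elems : List (Letter r)
    _≺_   : Letter r → Letter r → Set

LeftOf : ∀ {A : Set} → List A → A → A → Set
LeftOf w x y = ∃[ a ] ∃[ b ] ∃[ c ] (w ≡ a ++ (x ∷ b ++ (y ∷ c)))

InL : ∀ r n .{{_ : NonZero r}} → ColPoset r → List (Letter r) → Set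
InL r n P w = InG0 r n w × (w ↭ ColPoset.elems P)
            × (∀ x y → ColPoset._≺_ P x y → LeftOf w x y)

InCLP : ∀ r n .{{_ : NonZero r}} → ColPoset r → List (Letter r) → Set
InCLP r n P u = ∃[ w ] (InL r n P w × InCLw w u)

data ChainGen {r n} .{{_ : NonZero r}} (I : Subset n) (π : ColPerm r n)
     : Letter r → Letter r → Set where
  zeroStep : (k l : Fin r) → 1 Data.Nat.≤ toℕ k → toℕ l ≡ suc (toℕ k) →
             ChainGen I π (k , 0) (l , 0)
  chainStep : (i : Fin n) → ¬ (i ∈ I) →
              ChainGen I π (letter π i) (nextLetter π i)

C : ∀ {r n} .{{_ : NonZero r}} → Subset n → ColPerm r n → ColPoset r
C {r} I π = record
  { elems = oneLine π ++ zeroWord r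
  ; _≺_   = TransClosure (ChainGen I π)
  }

-- Write τ = σ⁻¹π.  Let w be a linear extension of C(I, π) and σ ∈ CL(w).  The
-- block of w after its k-th zero letter, recoloured by −k, is a subword of σ;
-- so if π(i) stands after k zero letters then σ contains π(i) recoloured by −k,
-- at position |τ(i)|, and τ(i) has colour k.  For i ∉ I, π(i) precedes π(i+1)
-- (or 0₁) in w, which forces τ(i) < τ(i+1): either π(i+1) lies in a later
-- block, or in the same block and then later in σ.  Hence Des(τ) ⊆ I.
-- Conversely, if Des(τ) ⊆ I then the generating relations of C(I, π) increase
-- under x ↦ σ⁻¹x (which fixes the zero letters and sends π(i) to τ(i)), so the
-- elements of C(I, π) listed in increasing order of σ⁻¹x form a linear
-- extension w₀.  Its k-th block consists of the π(i) with τ(i) of colour k,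
-- ordered by |τ(i)|; recoloured by −k these are the letters of σ of the
-- positions |τ(i)|, so σ is a shuffle of the blocks.

module Submission where

open import Defs
open import Data.Nat using (ℕ; NonZero)
open import Data.Fin.Subset using (Subset)
open import Data.Product using (_×_)

open import Data.Empty using (⊥-elim)
open import Data.Fin as F using (Fin; zero; suc; punchIn; toℕ; fromℕ<)
open import Data.Fin.Permutation as P using (Permutation′; _⟨$⟩ʳ_; _⟨$⟩ˡ_)
open import Data.Fin.Properties as F using (fromℕ<-toℕ; toℕ-fromℕ<; toℕ-injective; toℕ<n)
open import Data.Fin.Subset using () renaming (_∈_ to _∈ₛ_)
open import Data.Fin.Subset.Properties using (_∈?_)
open import Data.List using (List; []; _∷_; _++_; map; concat; filter; tabulate; length; drop; allFin)
open import Data.List.Membership.Propositional using (_∈_)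
open import Data.List.Membership.Propositional.Properties
  using (∈-++⁺ˡ; ∈-++⁺ʳ; ∈-map⁺; ∈-map⁻; ∈-allFin; ∈-tabulate⁺; ∈-∃++)
open import Data.List.Properties
  using (map-∘; map-++; map-tabulate; map-cong-local; concat-map; ++-identityʳ; ++-assoc; length-++;
         length-map; length-tabulate; filter-accept; filter-reject; tabulate-cong;
         ∷-injective; ∷-injectiveˡ; ∷-injectiveʳ)
open import Data.List.Relation.Binary.Permutation.Propositional
  using (_↭_; ↭-refl; ↭-trans; ↭-sym; ↭-reflexive; refl; prep; swap; trans; module PermutationReasoning)
import Data.List.Relation.Binary.Permutation.Propositional.Properties as ↭
open import Data.List.Relation.Binary.Permutation.Propositional.Properties using (∈-resp-↭)
open import Data.List.Relation.Binary.Sublist.Propositional using (_⊆_; []; _∷_; _∷ʳ_; ⊆-refl; ⊆-trans)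
open import Data.List.Relation.Binary.Sublist.Propositional.Properties using (Any-resp-⊆; ++⁺ʳ)
open import Data.List.Relation.Ternary.Interleaving using ([]; _∷ˡ_; _∷ʳ_)
import Data.List.Relation.Ternary.Interleaving.Properties as ILP
import Data.List.Relation.Ternary.Interleaving.Propositional as IL
open import Data.List.Relation.Unary.All as All using (All; []; _∷_)
import Data.List.Relation.Unary.All.Properties as AllP
open import Data.List.Relation.Unary.AllPairs as AllPairs using (AllPairs; []; _∷_)
import Data.List.Relation.Unary.AllPairs.Properties as APP
open import Data.List.Relation.Unary.Any using (here; there)
open import Data.List.Relation.Unary.Unique.Propositional using (Unique)
open import Data.List.Relation.Unary.Unique.Propositional.Properties using (allFin⁺)
open import Data.Nat using (>-nonZero⁻¹; zero; suc; _+_; _∸_; _<_; _≤_; _<?_; s≤s; z≤n)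
open import Data.Nat.DivMod using (_%_; _mod_; m%n%n≡m%n; %-distribˡ-+; [m+n]%n≡m%n; m%n<n; m<n⇒m%n≡m)
open import Data.Nat.Properties as ℕ
  using (+-comm; +-assoc; +-identityʳ; +-suc; +-cancelˡ-≡; m+[n∸m]≡n; m∸n+n≡m; m+n≮m;
         m≤m+n; n<1+n; ≤-reflexive; <⇒≤; <⇒≱; <-irrefl; 1+n≢n; suc-injective;
         module ≤-Reasoning)
open import Algebra.Properties.CommutativeSemigroup ℕ.+-commutativeSemigroup using (xy∙z≈xz∙y)
open import Data.Product using (_,_; proj₁; proj₂; ∃-syntax; Σ-syntax)
open import Data.Product.Relation.Binary.Lex.Strict using (×-strictTotalOrder)
open import Data.Sum using (inj₁; inj₂)
open import Function using (_∘_; id)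
open import Relation.Binary.Bundles using (StrictTotalOrder)
open import Relation.Binary.Construct.Closure.Transitive using (TransClosure; [_]; _∷_)
open import Relation.Binary.Definitions using (Asymmetric; DecidableEquality; tri<; tri≈; tri>)
open import Relation.Binary.PropositionalEquality as ≡
  using (_≡_; _≢_; refl; sym; cong; cong₂; subst; subst₂; module ≡-Reasoning)
open import Relation.Nullary using (¬_; yes; no)
open import Relation.Unary using (Decidable)
open import Relation.Unary.Properties using (∁?)

module _ {A : Set} where

  length≡0⇒≡[] : ∀ {xs : List A} → length xs ≡ 0 → xs ≡ []
  length≡0⇒≡[] {[]} _ = refl

  LeftOf-∷ : ∀ {w x y} (z : A) → LeftOf w x y → LeftOf (z ∷ w) x y
  LeftOf-∷ z (a , b , c , refl) = z ∷ a , b , c , refl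

  LeftOf-head : ∀ {w} {x y : A} → y ∈ w → LeftOf (x ∷ w) x y
  LeftOf-head y∈w with ∈-∃++ y∈w
  ... | b , c , refl = [] , b , c , refl

  LeftOf-resp-⊆ : ∀ {u w} {x y : A} → u ⊆ w → LeftOf u x y → LeftOf w x y
  LeftOf-resp-⊆ [] ([] , _ , _ , ())
  LeftOf-resp-⊆ [] (_ ∷ _ , _ , _ , ())
  LeftOf-resp-⊆ (z ∷ʳ u⊆w) l = LeftOf-∷ z (LeftOf-resp-⊆ u⊆w l)
  LeftOf-resp-⊆ (refl ∷ u⊆w) ([] , b , c , refl) =
    LeftOf-head (Any-resp-⊆ u⊆w (∈-++⁺ʳ b (here refl)))
  LeftOf-resp-⊆ (refl ∷ u⊆w) (_ ∷ a , b , c , refl) =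
    LeftOf-∷ _ (LeftOf-resp-⊆ u⊆w (a , b , c , refl))

  AllPairs-lookup : ∀ {R : A → A → Set} {w x y} → AllPairs R w → LeftOf w x y → R x y
  AllPairs-lookup (Rx ∷ _) ([] , b , c , refl) = All.lookup Rx (∈-++⁺ʳ b (here refl))
  AllPairs-lookup (_ ∷ Rw) (_ ∷ a , b , c , refl) = AllPairs-lookup Rw (a , b , c , refl)

  AllPairs⇒LeftOf : ∀ {R : A → A → Set} {w x y} → Asymmetric R → AllPairs R w →
                    x ∈ w → y ∈ w → R x y → LeftOf w x y
  AllPairs⇒LeftOf asym (_ ∷ _) (here refl) (here refl) Rxy = ⊥-elim (asym Rxy Rxy)
  AllPairs⇒LeftOf asym (_ ∷ _) (here refl) (there y∈w) _ = LeftOf-head y∈w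
  AllPairs⇒LeftOf asym (Rz ∷ _) (there x∈w) (here refl) Rxy = ⊥-elim (asym Rxy (All.lookup Rz x∈w))
  AllPairs⇒LeftOf asym (_ ∷ Rw) (there x∈w) (there y∈w) Rxy =
    LeftOf-∷ _ (AllPairs⇒LeftOf asym Rw x∈w y∈w Rxy)

  Interleaving⇒⊆ : ∀ {u v w : List A} → IL.Interleaving u v w → u ⊆ w
  Interleaving⇒⊆ [] = []
  Interleaving⇒⊆ (refl ∷ˡ s) = refl ∷ Interleaving⇒⊆ s
  Interleaving⇒⊆ (refl ∷ʳ s) = _ ∷ʳ Interleaving⇒⊆ s

  ShuffleOf⇒⊆ : ∀ {us : List (List A)} {u w} → ShuffleOf us w → u ∈ us → u ⊆ w
  ShuffleOf⇒⊆ (_ , _ , s) (here refl) = Interleaving⇒⊆ s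
  ShuffleOf⇒⊆ (_ , sh , s) (there u∈us) = ⊆-trans (ShuffleOf⇒⊆ sh u∈us) (Interleaving⇒⊆ (IL.swap s))

  ShuffleOf⇒↭ : ∀ {us : List (List A)} {w} → ShuffleOf us w → concat us ↭ w
  ShuffleOf⇒↭ {[]} refl = ↭-refl
  ShuffleOf⇒↭ {u ∷ us} (_ , sh , s) = ↭-trans (↭.++⁺ˡ u (ShuffleOf⇒↭ sh)) (↭-sym (IL.toPermutation s))

  Interleaving-++ˡ : ∀ {u v w} (a : List A) → IL.Interleaving u v w → IL.Interleaving (a ++ u) v (a ++ w)
  Interleaving-++ˡ [] s = s
  Interleaving-++ˡ (x ∷ a) s = refl ∷ˡ Interleaving-++ˡ a s

  Interleaving-filter : ∀ {P : A → Set} (P? : Decidable P) xs →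
                        IL.Interleaving (filter P? xs) (filter (∁? P?) xs) xs
  Interleaving-filter P? [] = []
  Interleaving-filter P? (x ∷ xs) with P? x
  ... | yes _ = refl ∷ˡ Interleaving-filter P? xs
  ... | no _ = refl ∷ʳ Interleaving-filter P? xs

  filter-filter-⇒ : ∀ {P Q : A → Set} (P? : Decidable P) (Q? : Decidable Q) →
                    (∀ {x} → P x → Q x) → ∀ xs → filter P? (filter Q? xs) ≡ filter P? xs
  filter-filter-⇒ P? Q? P⇒Q [] = refl
  filter-filter-⇒ P? Q? P⇒Q (x ∷ xs) with P? x
  ... | yes Px = ≡.trans (cong (filter P?) (filter-accept Q? (P⇒Q Px)))
                   (≡.trans (filter-accept P? Px) (cong (x ∷_) (filter-filter-⇒ P? Q? P⇒Q xs)))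
  ... | no ¬Px with Q? x
  ...   | yes _ = ≡.trans (filter-reject P? ¬Px) (filter-filter-⇒ P? Q? P⇒Q xs)
  ...   | no _ = filter-filter-⇒ P? Q? P⇒Q xs

module _ {A B : Set} (f : A → B) where

  ShuffleOf-map : ∀ {us : List (List A)} {w} → ShuffleOf us w → ShuffleOf (map (map f) us) (map f w)
  ShuffleOf-map {[]} refl = refl
  ShuffleOf-map {u ∷ us} (v , sh , s) =
    map f v , ShuffleOf-map sh , ILP.map⁺ f f f (IL.map (cong f) (cong f) s)

module _ {X K : Set} (key : X → K) (_≟_ : DecidableEquality K) where

  keyed : K → List X → List X
  keyed k = filter (λ x → key x ≟ k)

  ShuffleOf-keyed : ∀ {ks} → Unique ks → ∀ {xs} → All (λ x → key x ∈ ks) xs →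
                    ShuffleOf (map (λ k → keyed k xs) ks) xs
  ShuffleOf-keyed {[]} [] [] = refl
  ShuffleOf-keyed {k ∷ ks} (k∉ks ∷ ks!) {xs} keys∈ =
    others , subst (λ us → ShuffleOf us others) keyed-others (ShuffleOf-keyed ks! others-keys∈) ,
    Interleaving-filter (λ x → key x ≟ k) xs
    where
    others = filter (∁? (λ x → key x ≟ k)) xs
    others-keys∈ : All (λ x → key x ∈ ks) others
    others-keys∈ = All.map (λ { (here k≡ , k≢) → ⊥-elim (k≢ k≡) ; (there k∈ , _) → k∈ })
                     (All.zip (AllP.filter⁺ _ keys∈ , AllP.all-filter _ xs))
    keyed-others : map (λ k′ → keyed k′ others) ks ≡ map (λ k′ → keyed k′ xs) ks
    keyed-others = map-cong-local (All.map (λ k≢k′ →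
      filter-filter-⇒ _ _ (λ key≡k′ key≡k → k≢k′ (≡.trans (sym key≡k) key≡k′)) xs) k∉ks)

module _ {A : Set} where

  tabulate-index : ∀ {m} (f : Fin m → A) a {x b} → tabulate f ≡ a ++ x ∷ b →
                   ∃[ j ] toℕ j ≡ length a × f j ≡ x
  tabulate-index {suc m} f [] eq = zero , refl , ∷-injectiveˡ eq
  tabulate-index {suc m} f (_ ∷ a) eq with tabulate-index (f ∘ suc) a (∷-injectiveʳ eq)
  ... | j , j≡ , fj≡x = suc j , cong suc j≡ , fj≡x

  tabulate-↭-permute : ∀ {m} (f : Fin m → A) {ys xs} → ys ≡ tabulate f → ys ↭ xs →
                       Σ[ ρ ∈ Permutation′ m ] tabulate (f ∘ (ρ ⟨$⟩ʳ_)) ≡ xs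
  tabulate-↭-permute f ys≡ refl = P.id , sym ys≡
  tabulate-↭-permute {zero} f () (prep _ _)
  tabulate-↭-permute {suc m} f ys≡ (prep _ p) with ∷-injective ys≡
  ... | refl , ys≡′ with tabulate-↭-permute (f ∘ suc) ys≡′ p
  ...   | ρ , eq = P.lift₀ ρ , cong (f zero ∷_) eq
  tabulate-↭-permute {zero} f () (swap _ _ _)
  tabulate-↭-permute {suc zero} f () (swap _ _ _)
  tabulate-↭-permute {suc (suc m)} f ys≡ (swap _ _ p) with ∷-injective ys≡
  ... | refl , ys≡′ with ∷-injective ys≡′
  ...   | refl , ys≡″ with tabulate-↭-permute (λ k → f (suc (suc k))) ys≡″ p
  ...     | ρ , eq = P.swap ρ , cong (λ zs → f (suc zero) ∷ f zero ∷ zs) eq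
  tabulate-↭-permute f ys≡ (trans p q) with tabulate-↭-permute f ys≡ p
  ... | ρ₁ , eq₁ with tabulate-↭-permute (f ∘ (ρ₁ ⟨$⟩ʳ_)) (sym eq₁) q
  ...   | ρ₂ , eq₂ = ρ₂ P.∘ₚ ρ₁ , eq₂

  tabulate-↭-punchIn : ∀ {m} (f : Fin (suc m) → A) k → tabulate f ↭ f k ∷ tabulate (f ∘ punchIn k)
  tabulate-↭-punchIn f zero = ↭-refl
  tabulate-↭-punchIn {suc m} f (suc k) =
    ↭-trans (prep (f zero) (tabulate-↭-punchIn (f ∘ suc) k)) (swap _ _ ↭-refl)

  tabulate-permute-↭ : ∀ {m} (θ : Permutation′ m) (f : Fin m → A) → tabulate (f ∘ (θ ⟨$⟩ʳ_)) ↭ tabulate f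
  tabulate-permute-↭ {zero} θ f = ↭-refl
  tabulate-permute-↭ {suc m} θ f = ↭-trans
    (prep (f (θ ⟨$⟩ʳ zero)) (↭-trans
      (↭-reflexive (tabulate-cong (cong f ∘ P.punchIn-permute θ zero)))
      (tabulate-permute-↭ (P.remove zero θ) (f ∘ punchIn (θ ⟨$⟩ʳ zero)))))
    (↭-sym (tabulate-↭-punchIn f (θ ⟨$⟩ʳ zero)))

module ColourArithmetic (r : ℕ) .{{_ : NonZero r}} where

  open ≡-Reasoning

  infix 4 _≡ₘ_
  _≡ₘ_ : ℕ → ℕ → Set
  a ≡ₘ b = a % r ≡ b % r

  _⊖_ : Colour r → Colour r → Colour r
  c ⊖ d = addC c (negC d)

  toℕ-mod : ∀ a → toℕ (a mod r) ≡ₘ a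
  toℕ-mod a = ≡.trans (cong (_% r) (toℕ-fromℕ< _)) (m%n%n≡m%n a r)

  +-congʳₘ : ∀ {a b} c → a ≡ₘ b → a + c ≡ₘ b + c
  +-congʳₘ {a} {b} c a≡b = begin
    (a + c) % r            ≡⟨ %-distribˡ-+ a c r ⟩
    (a % r + c % r) % r    ≡⟨ cong (λ x → (x + c % r) % r) a≡b ⟩
    (b % r + c % r) % r    ≡⟨ %-distribˡ-+ b c r ⟨
    (b + c) % r            ∎

  +-congˡₘ : ∀ a {b c} → b ≡ₘ c → a + b ≡ₘ a + c
  +-congˡₘ a {b} {c} b≡c = begin
    (a + b) % r  ≡⟨ cong (_% r) (+-comm a b) ⟩
    (b + a) % r  ≡⟨ +-congʳₘ a b≡c ⟩
    (c + a) % r  ≡⟨ cong (_% r) (+-comm c a) ⟩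
    (a + c) % r  ∎

  +-+-inverseₘ : ∀ a k → a + k + (r ∸ k % r) ≡ₘ a
  +-+-inverseₘ a k = begin
    (a + k + (r ∸ k % r)) % r        ≡⟨ +-congʳₘ (r ∸ k % r) (+-congˡₘ a (m%n%n≡m%n k r)) ⟨
    (a + k % r + (r ∸ k % r)) % r    ≡⟨ cong (_% r) (+-assoc a (k % r) _) ⟩
    (a + (k % r + (r ∸ k % r))) % r  ≡⟨ cong (λ x → (a + x) % r) (m+[n∸m]≡n (<⇒≤ (m%n<n k r))) ⟩
    (a + r) % r                      ≡⟨ [m+n]%n≡m%n a r ⟩
    a % r                            ∎

  +-cancelₘ : ∀ {a b k c} → a < r → b < r → a + k ≡ₘ c → b + k ≡ₘ c → a ≡ b
  +-cancelₘ {a} {b} {k} {c} a<r b<r a+k≡c b+k≡c = begin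
    a                            ≡⟨ m<n⇒m%n≡m a<r ⟨
    a % r                        ≡⟨ +-+-inverseₘ a k ⟨
    (a + k + (r ∸ k % r)) % r    ≡⟨ +-congʳₘ _ a+k≡c ⟩
    (c + (r ∸ k % r)) % r        ≡⟨ +-congʳₘ _ b+k≡c ⟨
    (b + k + (r ∸ k % r)) % r    ≡⟨ +-+-inverseₘ b k ⟩
    b % r                        ≡⟨ m<n⇒m%n≡m b<r ⟩
    b                            ∎

  ⊖-+ₘ : ∀ c d → toℕ (c ⊖ d) + toℕ d ≡ₘ toℕ c
  ⊖-+ₘ c d = begin
    (toℕ (c ⊖ d) + toℕ d) % r           ≡⟨ +-congʳₘ (toℕ d) (toℕ-mod (toℕ c + toℕ (negC d))) ⟩
    (toℕ c + toℕ (negC d) + toℕ d) % r  ≡⟨ +-congʳₘ (toℕ d) (+-congˡₘ (toℕ c) (toℕ-mod (r ∸ toℕ d))) ⟩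
    (toℕ c + (r ∸ toℕ d) + toℕ d) % r   ≡⟨ cong (_% r) (+-assoc (toℕ c) _ _) ⟩
    (toℕ c + (r ∸ toℕ d + toℕ d)) % r   ≡⟨ cong (λ x → (toℕ c + x) % r) (m∸n+n≡m (<⇒≤ (toℕ<n d))) ⟩
    (toℕ c + r) % r                     ≡⟨ [m+n]%n≡m%n (toℕ c) r ⟩
    toℕ c % r                           ∎

  subC-+ₘ : ∀ c i → toℕ (subC c i) + i ≡ₘ toℕ c
  subC-+ₘ c i = begin
    (toℕ (subC c i) + i) % r               ≡⟨ +-congʳₘ i (toℕ-mod (toℕ c + (r ∸ toℕ (i mod r)))) ⟩
    (toℕ c + (r ∸ toℕ (i mod r)) + i) % r
      ≡⟨ cong (λ x → (toℕ c + (r ∸ x) + i) % r) (toℕ-fromℕ< (m%n<n i r)) ⟩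
    (toℕ c + (r ∸ i % r) + i) % r          ≡⟨ cong (_% r) (xy∙z≈xz∙y (toℕ c) _ i) ⟩
    (toℕ c + i + (r ∸ i % r)) % r          ≡⟨ +-+-inverseₘ (toℕ c) i ⟩
    toℕ c % r                              ∎

  subC-⊖ : ∀ c d → subC c (toℕ (c ⊖ d)) ≡ d
  subC-⊖ c d = toℕ-injective (+-cancelₘ (toℕ<n _) (toℕ<n d) (subC-+ₘ c (toℕ (c ⊖ d)))
    (≡.trans (cong (_% r) (+-comm (toℕ d) _)) (⊖-+ₘ c d)))

  toℕ-⊖-subC : ∀ c {z} → z < r → toℕ (c ⊖ subC c z) ≡ z
  toℕ-⊖-subC c {z} z<r = +-cancelₘ (toℕ<n _) z<r (⊖-+ₘ c (subC c z))
    (≡.trans (cong (_% r) (+-comm z _)) (subC-+ₘ c z))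

module _ {r : ℕ} where

  zeros : List (Letter r) → List (Letter r)
  zeros [] = []
  zeros ((k , zero) ∷ w) = (k , zero) ∷ zeros w
  zeros ((k , suc v) ∷ w) = zeros w

  zeros-++ : ∀ a b → zeros (a ++ b) ≡ zeros a ++ zeros b
  zeros-++ [] b = refl
  zeros-++ ((k , zero) ∷ a) b = cong ((k , zero) ∷_) (zeros-++ a b)
  zeros-++ ((k , suc v) ∷ a) b = zeros-++ a b

  zeros-Interleaving : ∀ {u v w} → IL.Interleaving u v w → zeros u ≡ [] → zeros w ≡ zeros v
  zeros-Interleaving [] _ = refl
  zeros-Interleaving (_∷ˡ_ {a = k , suc _} refl s) u-free = zeros-Interleaving s u-free
  zeros-Interleaving (_∷ʳ_ {b = k , zero} refl s) u-free = cong ((k , zero) ∷_) (zeros-Interleaving s u-free)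
  zeros-Interleaving (_∷ʳ_ {b = k , suc _} refl s) u-free = zeros-Interleaving s u-free

  zeros-map-letter : ∀ {n m} (ρ : ColPerm r n) (h : Fin m → Fin n) xs → zeros (map (letter ρ ∘ h) xs) ≡ []
  zeros-map-letter ρ h [] = refl
  zeros-map-letter ρ h (x ∷ xs) = zeros-map-letter ρ h xs

  zeros-zeroWord : zeros (zeroWord r) ≡ zeroWord r
  zeros-zeroWord = zeros-map-zero (drop 1 (allFin r))
    where
    zeros-map-zero : ∀ ks → zeros (map (λ k → (k , 0)) ks) ≡ map (λ k → (k , 0)) ks
    zeros-map-zero [] = refl
    zeros-map-zero (k ∷ ks) = cong ((k , 0) ∷_) (zeros-map-zero ks)

  InG0⇒zeros : ∀ {n w} → InG0 r n w → zeros w ≡ zeroWord r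
  InG0⇒zeros (ρ , s) = ≡.trans (zeros-Interleaving s (zeros-map-letter ρ id (allFin _))) zeros-zeroWord

  splitZeros-nonempty : ∀ (w : List (Letter r)) → ∃[ s ] ∃[ ss ] splitZeros w ≡ s ∷ ss
  splitZeros-nonempty [] = [] , [] , refl
  splitZeros-nonempty ((k , zero) ∷ w) = [] , splitZeros w , refl
  splitZeros-nonempty ((k , suc v) ∷ w) with splitZeros w | splitZeros-nonempty w
  ... | _ | s , ss , refl = (k , suc v) ∷ s , ss , refl

  splitZeros-++ : ∀ (u : List (Letter r)) {c s ss} → zeros u ≡ [] → splitZeros c ≡ s ∷ ss →
                  splitZeros (u ++ c) ≡ (u ++ s) ∷ ss
  splitZeros-++ [] _ eq = eq
  splitZeros-++ ((k , suc v) ∷ u) {c} u-free eq with splitZeros (u ++ c) | splitZeros-++ u {c} u-free eq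
  ... | _ | refl = refl

  splitZeros-markers : ∀ {j} (u : List (Letter r)) (c : Fin j → Colour r) (f : Fin j → List (Letter r)) →
    zeros u ≡ [] → (∀ k → zeros (f k) ≡ []) →
    splitZeros (u ++ concat (tabulate (λ k → (c k , 0) ∷ f k))) ≡ u ∷ tabulate f
  splitZeros-markers {zero} u c f u-free f-free =
    ≡.trans (splitZeros-++ u u-free refl) (cong (_∷ []) (++-identityʳ u))
  splitZeros-markers {suc j} u c f u-free f-free =
    ≡.trans (splitZeros-++ u u-free refl)
      (cong₂ _∷_ (++-identityʳ u)
        (splitZeros-markers (f zero) (c ∘ F.suc) (f ∘ F.suc) (f-free zero) (f-free ∘ F.suc)))

  Interleaving-markers : ∀ {j} (c : Fin j → Colour r) (f : Fin j → List (Letter r)) →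
    IL.Interleaving (concat (tabulate f)) (tabulate (λ k → (c k , 0))) (concat (tabulate (λ k → (c k , 0) ∷ f k)))
  Interleaving-markers {zero} c f = []
  Interleaving-markers {suc j} c f =
    refl ∷ʳ Interleaving-++ˡ (f zero) (Interleaving-markers (c ∘ F.suc) (f ∘ F.suc))

zeroWord-index : ∀ {m} a {k v b} → zeroWord (suc m) ≡ a ++ (k , v) ∷ b → toℕ k ≡ suc (length a)
zeroWord-index {m} a eq
  with tabulate-index (λ j → (suc j , 0)) a (≡.trans (sym (map-tabulate {n = m} suc (λ k → (k , 0)))) eq)
... | j , j≡ , refl = cong suc j≡

module Segments (r : ℕ) .{{_ : NonZero r}} where

  shiftLetter : ℕ → Letter r → Letter r
  shiftLetter i (k , x) = (subC k i , x)

  shiftFrom-splitZeros-∷ : ∀ i k v w {t} → t ∈ shiftFrom i (splitZeros w) →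
    ∃[ t′ ] t′ ∈ shiftFrom i (splitZeros ((k , suc v) ∷ w)) × t ⊆ t′
  shiftFrom-splitZeros-∷ i k v w t∈ with splitZeros w
  ... | [] with () ← t∈
  ... | s ∷ ss with t∈
  ...   | here refl = _ , here refl , _ ∷ʳ ⊆-refl
  ...   | there t∈′ = _ , there t∈′ , ⊆-refl

  segment-⊆ : ∀ i a {u} c → zeros u ≡ [] →
    ∃[ t ] t ∈ shiftFrom i (splitZeros (a ++ u ++ c)) × map (shiftLetter (i + length (zeros a))) u ⊆ t
  segment-⊆ i [] {u} c u-free with splitZeros-nonempty c
  ... | s , ss , eq =
    _ , subst (λ S → _ ∈ shiftFrom i S) (sym (splitZeros-++ u u-free eq)) (here refl) ,
    subst₂ (λ j t → map (shiftLetter j) u ⊆ t) (sym (+-identityʳ i)) (sym (map-++ (shiftLetter i) u s))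
      (++⁺ʳ _ ⊆-refl)
  segment-⊆ i ((k , zero) ∷ a) c u-free with segment-⊆ (suc i) a c u-free
  ... | t , t∈ , u⊆t rewrite +-suc i (length (zeros a)) = t , there t∈ , u⊆t
  segment-⊆ i ((k , suc v) ∷ a) {u} c u-free with segment-⊆ i a c u-free
  ... | t , t∈ , u⊆t with shiftFrom-splitZeros-∷ i k v (a ++ u ++ c) t∈
  ...   | t′ , t′∈ , t⊆t′ = t′ , t′∈ , ⊆-trans u⊆t t⊆t′

  shiftFrom-tabulate : ∀ {j} i (f : Fin j → List (Letter r)) →
    shiftFrom i (tabulate f) ≡ tabulate (λ k → map (shiftLetter (i + toℕ k)) (f k))
  shiftFrom-tabulate {zero} i f = refl
  shiftFrom-tabulate {suc j} i f = cong₂ _∷_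
    (cong (λ x → map (shiftLetter x) (f zero)) (sym (+-identityʳ i)))
    (≡.trans (shiftFrom-tabulate (suc i) (f ∘ F.suc))
      (tabulate-cong (λ k → cong (λ x → map (shiftLetter x) (f (F.suc k))) (sym (+-suc i (toℕ k))))))

oneLine-positions : ∀ {r n} (ρ : ColPerm r n) →
  AllPairs (λ x y → ∃[ p ] ∃[ q ] p F.< q × letter ρ p ≡ x × letter ρ q ≡ y) (oneLine ρ)
oneLine-positions ρ = APP.map⁺ (APP.tabulate⁺-< (λ {p} {q} p<q → p , q , p<q , refl , refl))

<L-strictTotalOrder : ℕ → StrictTotalOrder _ _ _
<L-strictTotalOrder r = ×-strictTotalOrder (F.<-strictTotalOrder r) ℕ.<-strictTotalOrder

<L⇒colour≤ : ∀ {r} {x y : Letter r} → x <L y → toℕ (proj₁ x) ≤ toℕ (proj₁ y)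
<L⇒colour≤ (inj₁ lt) = <⇒≤ lt
<L⇒colour≤ (inj₂ (refl , _)) = ≤-reflexive refl

module _ {r : ℕ} .{{_ : NonZero r}} where

  -- Letters of absolute value beyond n do not occur; they are left fixed.
  _⟪_⟫ : ∀ {n} → ColPerm r n → Letter r → Letter r
  ρ ⟪ c , zero ⟫ = c , zero
  _⟪_⟫ {n} ρ (c , suc v) with v <? n
  ... | yes v<n = addC c (colour ρ (fromℕ< v<n)) , suc (toℕ (perm ρ ⟨$⟩ʳ fromℕ< v<n))
  ... | no _ = c , suc v

  module _ {n} (ρ π : ColPerm r n) where

    ⟪⟫-letter : ∀ i → ρ ⟪ letter π i ⟫ ≡ letter (ρ · π) i
    ⟪⟫-letter i with toℕ (perm π ⟨$⟩ʳ i) <? n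
    ... | yes v<n rewrite fromℕ<-toℕ (perm π ⟨$⟩ʳ i) v<n = refl
    ... | no v≮n = ⊥-elim (v≮n (toℕ<n _))

    ⟪⟫-nextLetter : ∀ i → ρ ⟪ nextLetter π i ⟫ ≡ nextLetter (ρ · π) i
    ⟪⟫-nextLetter i with suc (toℕ i) <? n
    ... | yes _ = ⟪⟫-letter _
    ... | no _ = refl

  value-letter≢nextLetter : ∀ {n} (ρ : ColPerm r n) i →
                            proj₂ (letter ρ i) ≢ proj₂ (nextLetter ρ i)
  value-letter≢nextLetter {n} ρ i v≡ with suc (toℕ i) <? n
  ... | yes i+1<n = 1+n≢n (≡.trans (sym (toℕ-fromℕ< i+1<n)) (cong toℕ (sym i≡i+1)))
    where
    i≡i+1 : i ≡ fromℕ< i+1<n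
    i≡i+1 = ≡.trans (sym (P.inverseˡ (perm ρ)))
              (≡.trans (cong (perm ρ ⟨$⟩ˡ_) (toℕ-injective (suc-injective v≡))) (P.inverseˡ (perm ρ)))
  ... | no _ with () ← v≡

-- Necessity: a linear extension forbids descents outside I

module Necessity {m n : ℕ} (σ π : ColPerm (suc m) n) where

  open ColourArithmetic (suc m)
  open Segments (suc m)

  τ : ColPerm (suc m) n
  τ = inv σ · π

  τ-from-σ-letter : ∀ {i p z} → z < suc m → letter σ p ≡ shiftLetter z (letter π i) →
                    toℕ (colour τ i) ≡ z × perm τ ⟨$⟩ʳ i ≡ p
  τ-from-σ-letter {i} {p} {z} z<r eq = colour-τ , perm-τ
    where
    perm-τ : perm σ ⟨$⟩ˡ (perm π ⟨$⟩ʳ i) ≡ p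
    perm-τ = ≡.trans (cong (perm σ ⟨$⟩ˡ_) (toℕ-injective (suc-injective (cong proj₂ (sym eq)))))
                     (P.inverseˡ (perm σ))
    colour-τ : toℕ (colour π i ⊖ colour σ (perm σ ⟨$⟩ˡ (perm π ⟨$⟩ʳ i))) ≡ z
    colour-τ rewrite perm-τ | cong proj₁ eq = toℕ-⊖-subC (colour π i) z<r

  module _ {w} (w∈G0 : InG0 (suc m) n w) (σ∈CLw : ShuffleOf (pis w) (oneLine σ)) where

    run-⊆ : ∀ a {u} c → zeros u ≡ [] → w ≡ a ++ u ++ c →
            map (shiftLetter (length (zeros a))) u ⊆ oneLine σ
    run-⊆ a c u-free refl with segment-⊆ 0 a c u-free
    ... | t , t∈ , u⊆t = ⊆-trans u⊆t (ShuffleOf⇒⊆ σ∈CLw t∈)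

    zeros-prefix< : ∀ a {c} → w ≡ a ++ c → length (zeros a) < suc m
    zeros-prefix< a {c} refl = s≤s (begin
      length (zeros a)                        ≤⟨ m≤m+n _ _ ⟩
      length (zeros a) + length (zeros c)     ≡⟨ length-++ (zeros a) ⟨
      length (zeros a ++ zeros c)             ≡⟨ cong length (zeros-++ a c) ⟨
      length (zeros (a ++ c))                 ≡⟨ cong length (InG0⇒zeros w∈G0) ⟩
      length (zeroWord (suc m))               ≡⟨ length-map _ (tabulate {n = m} F.suc) ⟩
      length (tabulate {n = m} F.suc)         ≡⟨ length-tabulate F.suc ⟩
      m                                       ∎)
      where open ≤-Reasoning

    colour-τ≡zeros-before : ∀ a i c → w ≡ a ++ letter π i ∷ c → toℕ (colour τ i) ≡ length (zeros a)
    colour-τ≡zeros-before a i c eq with ∈-map⁻ (letter σ) (Any-resp-⊆ (run-⊆ a c refl eq) (here refl))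
    ... | p , _ , eq′ = proj₁ (τ-from-σ-letter (zeros-prefix< a eq) (sym eq′))

    same-run-ordered : ∀ a b c {i j} → zeros b ≡ [] → w ≡ a ++ letter π i ∷ b ++ letter π j ∷ c →
                       perm τ ⟨$⟩ʳ i F.< perm τ ⟨$⟩ʳ j
    same-run-ordered a b c {i} {j} b-free eq
      with AllPairs-lookup (oneLine-positions σ) (LeftOf-resp-⊆ run-in-σ run-head-last)
      where
      u = letter π i ∷ b ++ letter π j ∷ []
      f = shiftLetter (length (zeros a))
      run-in-σ : map f u ⊆ oneLine σ
      run-in-σ = run-⊆ a c (≡.trans (zeros-++ b _) (cong (_++ []) b-free))
                   (≡.trans eq (cong (λ v → a ++ letter π i ∷ v) (sym (++-assoc b _ c))))
      run-head-last : LeftOf (map f u) (f (letter π i)) (f (letter π j))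
      run-head-last = [] , map f b , [] , cong (f (letter π i) ∷_) (map-++ f b _)
    ... | p , q , p<q , eq-p , eq-q
      rewrite proj₂ (τ-from-σ-letter (zeros-prefix< a eq) eq-p)
            | proj₂ (τ-from-σ-letter (zeros-prefix< a eq) eq-q) = p<q

    LeftOf⇒τ≯ : ∀ {i j} → LeftOf w (letter π i) (letter π j) → ¬ (letter τ j <L letter τ i)
    LeftOf⇒τ≯ {i} {j} (a , b , c , eq) = λ
      { (inj₁ cj<ci) → m+n≮m _ _ (subst₂ _<_ cj ci cj<ci)
      ; (inj₂ (cj≡ci , vj<vi)) → <⇒≱ vj<vi (<⇒≤ (s≤s (same-run-ordered a b c (b-free cj≡ci) eq)))
      }
      where
      ci : toℕ (colour τ i) ≡ length (zeros a)
      ci = colour-τ≡zeros-before a i _ eq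
      cj : toℕ (colour τ j) ≡ length (zeros a) + length (zeros b)
      cj = ≡.trans (colour-τ≡zeros-before (a ++ letter π i ∷ b) j c (≡.trans eq (sym (++-assoc a _ _))))
             (≡.trans (cong length (zeros-++ a (letter π i ∷ b))) (length-++ (zeros a)))
      b-free : colour τ j ≡ colour τ i → zeros b ≡ []
      b-free cj≡ci = length≡0⇒≡[] (+-cancelˡ-≡ (length (zeros a)) _ 0
        (≡.trans (sym cj) (≡.trans (cong toℕ cj≡ci) (≡.trans ci (sym (+-identityʳ _))))))

    zeros-before-zero : ∀ a {k c} → w ≡ a ++ (k , 0) ∷ c → toℕ k ≡ suc (length (zeros a))
    zeros-before-zero a {k} {c} eq = zeroWord-index (zeros a) (begin
      zeroWord (suc m)              ≡⟨ InG0⇒zeros w∈G0 ⟨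
      zeros w                       ≡⟨ cong zeros eq ⟩
      zeros (a ++ (k , 0) ∷ c)      ≡⟨ zeros-++ a _ ⟩
      zeros a ++ (k , 0) ∷ zeros c  ∎)
      where open ≡-Reasoning

    LeftOf-zero⇒τ≯ : ∀ {i k} → LeftOf w (letter π i) (k , 0) → ¬ ((k , 0) <L letter τ i)
    LeftOf-zero⇒τ≯ {i} {k} (a , b , c , eq) k<τi = <-irrefl refl (begin-strict
      toℕ k                                ≤⟨ <L⇒colour≤ k<τi ⟩
      toℕ (colour τ i)                     ≡⟨ colour-τ≡zeros-before a i _ eq ⟩
      length (zeros a)                     ≤⟨ m≤m+n _ _ ⟩
      length (zeros a) + length (zeros b)  ≡⟨ length-++ (zeros a) ⟨
      length (zeros a ++ zeros b)          ≡⟨ cong length (zeros-++ a (letter π i ∷ b)) ⟨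
      length (zeros (a ++ letter π i ∷ b)) <⟨ n<1+n _ ⟩
      suc (length (zeros (a ++ letter π i ∷ b)))
        ≡⟨ zeros-before-zero (a ++ letter π i ∷ b) (≡.trans eq (sym (++-assoc a _ _))) ⟨
      toℕ k                                ∎)
      where open ≤-Reasoning

    no-descent : ∀ i → LeftOf w (letter π i) (nextLetter π i) → ¬ IsDes τ i
    no-descent i with suc (toℕ i) <? n
    ... | yes _ = LeftOf⇒τ≯
    ... | no _ = LeftOf-zero⇒τ≯

  CL⇒DesSubset : ∀ I → InCLP (suc m) n (C I π) (oneLine σ) → DesSubset τ I
  CL⇒DesSubset I (w , (w∈G0 , _ , ordered) , σ∈CLw) i i-des with i ∈? I
  ... | yes i∈I = i∈I
  ... | no i∉I = ⊥-elim (no-descent w∈G0 σ∈CLw i (ordered _ _ [ chainStep i i∉I ]) i-des)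

-- Sufficiency: listing C(I, π) in increasing order of σ⁻¹

module Sufficiency {m n : ℕ} (σ π : ColPerm (suc m) n) (I : Subset n) where

  open ColourArithmetic (suc m)
  open Segments (suc m)
  open StrictTotalOrder (<L-strictTotalOrder (suc m)) using (compare) renaming (trans to <L-trans; asym to <L-asym)

  L : Set
  L = Letter (suc m)

  τ : ColPerm (suc m) n
  τ = inv σ · π

  κ : L → L
  κ x = inv σ ⟪ x ⟫

  elems : List L
  elems = oneLine π ++ zeroWord (suc m)

  letter∈elems : ∀ i → letter π i ∈ elems
  letter∈elems i = ∈-++⁺ˡ (∈-map⁺ (letter π) (∈-allFin i))

  zero∈elems : ∀ {k} → 0 < toℕ k → (k , 0) ∈ elems
  zero∈elems {suc k} _ = ∈-++⁺ʳ (oneLine π) (∈-map⁺ (λ c → (c , 0)) (∈-tabulate⁺ k))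

  -- src p is the position of π holding the absolute value of σ(p), so that |τ(src p)| = p + 1.
  src : Fin n → Fin n
  src p = perm π ⟨$⟩ˡ (perm σ ⟨$⟩ʳ p)

  key : Fin n → Colour (suc m)
  key p = colour τ (src p)

  srcLetter : Fin n → L
  srcLetter p = letter π (src p)

  perm-τ-src : ∀ p → perm τ ⟨$⟩ʳ src p ≡ p
  perm-τ-src p = ≡.trans (cong (perm σ ⟨$⟩ˡ_) (P.inverseʳ (perm π))) (P.inverseˡ (perm σ))

  κ-srcLetter : ∀ p → κ (srcLetter p) ≡ (key p , suc (toℕ p))
  κ-srcLetter p = ≡.trans (⟪⟫-letter (inv σ) π (src p)) (cong (λ q → key p , suc (toℕ q)) (perm-τ-src p))

  shift-srcLetter : ∀ p → shiftLetter (toℕ (key p)) (srcLetter p) ≡ letter σ p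
  shift-srcLetter p = cong₂ _,_
    (≡.trans (subC-⊖ (colour π (src p)) (colour σ (perm τ ⟨$⟩ʳ src p))) (cong (colour σ) (perm-τ-src p)))
    (cong (suc ∘ toℕ) (P.inverseʳ (perm π)))

  block : Colour (suc m) → List (Fin n)
  block c = keyed key F._≟_ c (allFin n)

  map-block : ∀ {B : Set} {f g : Fin n → B} c → (∀ p → key p ≡ c → f p ≡ g p) →
              map f (block c) ≡ map g (block c)
  map-block c f≡g = map-cong-local (All.map (λ {p} → f≡g p) (AllP.all-filter _ (allFin n)))

  blocks-shuffle : ShuffleOf (tabulate block) (allFin n)
  blocks-shuffle = subst (λ us → ShuffleOf us (allFin n)) (map-tabulate id block)
    (ShuffleOf-keyed key F._≟_ (allFin⁺ (suc m)) (AllP.tabulate⁺ (λ p → ∈-allFin (key p))))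

  seg : Colour (suc m) → List L
  seg c = map srcLetter (block c)

  seg-shift : ∀ c → map (shiftLetter (toℕ c)) (seg c) ≡ map (letter σ) (block c)
  seg-shift c = ≡.trans (sym (map-∘ (block c))) (map-block c (λ p key≡c →
    subst (λ c′ → shiftLetter (toℕ c′) (srcLetter p) ≡ letter σ p) key≡c (shift-srcLetter p)))

  κ-seg : ∀ c → map κ (seg c) ≡ map (λ p → c , suc (toℕ p)) (block c)
  κ-seg c = ≡.trans (sym (map-∘ (block c))) (map-block c (λ p key≡c →
    ≡.trans (κ-srcLetter p) (cong (λ c′ → c′ , suc (toℕ p)) key≡c)))

  marker : Colour (suc m) → List L
  marker zero = []
  marker (suc k) = (suc k , 0) ∷ []

  -- Band c is 0_c (for c ≠ 0) followed by the π(i) with τ(i) of colour c, by increasing |τ(i)|.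
  band : Colour (suc m) → List L
  band c = marker c ++ seg c

  w₀ : List L
  w₀ = concat (tabulate band)

  nonzero-part : concat (tabulate seg) ≡ map srcLetter (concat (tabulate block))
  nonzero-part = ≡.trans (cong concat (sym (map-tabulate block (map srcLetter)))) (concat-map (tabulate block))

  w₀-interleaving : IL.Interleaving (concat (tabulate seg)) (zeroWord (suc m)) w₀
  w₀-interleaving = subst (λ z → IL.Interleaving (concat (tabulate seg)) z w₀)
    (sym (map-tabulate F.suc (λ k → k , 0)))
    (Interleaving-++ˡ (seg zero) (Interleaving-markers F.suc (seg ∘ F.suc)))

  w₀-↭ : w₀ ↭ elems
  w₀-↭ = ↭-trans (IL.toPermutation w₀-interleaving) (↭.++⁺ʳ (zeroWord (suc m)) (begin
    concat (tabulate seg)                    ≡⟨ nonzero-part ⟩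
    map srcLetter (concat (tabulate block))  ↭⟨ ↭.map⁺ _ (ShuffleOf⇒↭ blocks-shuffle) ⟩
    map srcLetter (allFin n)                 ≡⟨ map-tabulate id _ ⟩
    tabulate (letter π ∘ src)                ↭⟨ tabulate-permute-↭ (perm σ P.∘ₚ P.flip (perm π)) (letter π) ⟩
    tabulate (letter π)                      ≡⟨ map-tabulate id (letter π) ⟨
    oneLine π                                ∎))
    where open PermutationReasoning

  w₀∈G0 : InG0 (suc m) n w₀
  w₀∈G0 with tabulate-↭-permute id refl (↭-sym (ShuffleOf⇒↭ blocks-shuffle))
  ... | ρ , tabulate-ρ =
    π′ , subst (λ u → IL.Interleaving u (zeroWord (suc m)) w₀) (sym oneLine-π′) w₀-interleaving
    where
    π′ : ColPerm (suc m) n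
    π′ = colPerm (colour π ∘ src ∘ (ρ ⟨$⟩ʳ_)) (ρ P.∘ₚ perm σ)
    letter-π′ : ∀ k → letter π′ k ≡ srcLetter (ρ ⟨$⟩ʳ k)
    letter-π′ k = cong (λ q → colour π′ k , suc (toℕ q)) (sym (P.inverseʳ (perm π)))
    oneLine-π′ : oneLine π′ ≡ concat (tabulate seg)
    oneLine-π′ = begin
      oneLine π′                               ≡⟨ map-tabulate id (letter π′) ⟩
      tabulate (letter π′)                     ≡⟨ tabulate-cong letter-π′ ⟩
      tabulate (srcLetter ∘ (ρ ⟨$⟩ʳ_))          ≡⟨ map-tabulate (ρ ⟨$⟩ʳ_) srcLetter ⟨
      map srcLetter (tabulate (ρ ⟨$⟩ʳ_))        ≡⟨ cong (map srcLetter) tabulate-ρ ⟩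
      map srcLetter (concat (tabulate block))  ≡⟨ nonzero-part ⟨
      concat (tabulate seg)                    ∎
      where open ≡-Reasoning

  σ∈CLw₀ : ShuffleOf (pis w₀) (oneLine σ)
  σ∈CLw₀ = subst (λ us → ShuffleOf us (oneLine σ)) (sym pis-w₀)
    (subst (λ us → ShuffleOf us (oneLine σ)) (map-tabulate block (map (letter σ)))
      (ShuffleOf-map (letter σ) blocks-shuffle))
    where
    seg-zero-free : ∀ c → zeros (seg c) ≡ []
    seg-zero-free c = zeros-map-letter π src (block c)
    pis-w₀ : pis w₀ ≡ tabulate (λ c → map (letter σ) (block c))
    pis-w₀ = begin
      shiftFrom 0 (splitZeros w₀)
        ≡⟨ cong (shiftFrom 0) (splitZeros-markers (seg zero) F.suc (seg ∘ F.suc)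
                                 (seg-zero-free zero) (seg-zero-free ∘ F.suc)) ⟩
      shiftFrom 0 (tabulate seg)                          ≡⟨ shiftFrom-tabulate 0 seg ⟩
      tabulate (λ c → map (shiftLetter (toℕ c)) (seg c))  ≡⟨ tabulate-cong seg-shift ⟩
      tabulate (λ c → map (letter σ) (block c))           ∎
      where open ≡-Reasoning

  image : Colour (suc m) → List L
  image c = marker c ++ map (λ p → c , suc (toℕ p)) (block c)

  κ-band : ∀ c → map κ (band c) ≡ image c
  κ-band c = ≡.trans (map-++ κ (marker c) (seg c)) (cong₂ _++_ (κ-marker c) (κ-seg c))
    where
    κ-marker : ∀ c → map κ (marker c) ≡ marker c
    κ-marker zero = refl
    κ-marker (suc k) = refl

  image-sorted : ∀ c → AllPairs _<L_ (image c)
  image-sorted c = marker-sorted c (APP.map⁺ (AllPairs.map (λ p<q → inj₂ (refl , s≤s p<q))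
                     (APP.filter⁺ _ (APP.tabulate⁺-< id))))
    where
    marker-sorted : ∀ c {ps} → AllPairs _<L_ (map (λ p → c , suc (toℕ p)) ps) →
                    AllPairs _<L_ (marker c ++ map (λ p → c , suc (toℕ p)) ps)
    marker-sorted zero s = s
    marker-sorted (suc k) {ps} s = AllP.map⁺ (All.universal (λ _ → inj₂ (refl , s≤s z≤n)) ps) ∷ s

  image-colour : ∀ c → All (λ y → proj₁ y ≡ c) (image c)
  image-colour c = AllP.++⁺ (marker-colour c) (AllP.map⁺ (All.universal (λ _ → refl) (block c)))
    where
    marker-colour : ∀ c → All (λ y → proj₁ y ≡ c) (marker c)
    marker-colour zero = []
    marker-colour (suc k) = refl ∷ []

  w₀-sorted : AllPairs (λ x y → κ x <L κ y) w₀
  w₀-sorted = APP.concat⁺ (AllP.tabulate⁺ band-sorted) (APP.tabulate⁺-< bands-ordered)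
    where
    band-sorted : ∀ c → AllPairs (λ x y → κ x <L κ y) (band c)
    band-sorted c = APP.map⁻ (subst (AllPairs _<L_) (sym (κ-band c)) (image-sorted c))
    band-colour : ∀ c → All (λ x → proj₁ (κ x) ≡ c) (band c)
    band-colour c = AllP.map⁻ (subst (All (λ y → proj₁ y ≡ c)) (sym (κ-band c)) (image-colour c))
    bands-ordered : ∀ {c c′} → c F.< c′ → All (λ x → All (λ y → κ x <L κ y) (band c′)) (band c)
    bands-ordered c<c′ = All.map (λ κx≡c → All.map (λ κy≡c′ →
      inj₁ (subst₂ F._<_ (sym κx≡c) (sym κy≡c′) c<c′)) (band-colour _)) (band-colour _)

  nondescent-increasing : DesSubset τ I → ∀ {i} → ¬ (i ∈ₛ I) → letter τ i <L nextLetter τ i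
  nondescent-increasing des {i} i∉I with compare (letter τ i) (nextLetter τ i)
  ... | tri< lt _ _ = lt
  ... | tri≈ _ (_ , v≡) _ = ⊥-elim (value-letter≢nextLetter τ i v≡)
  ... | tri> _ _ gt = ⊥-elim (i∉I (des i gt))

  generator-increasing : DesSubset τ I → ∀ {x y} → ChainGen I π x y →
                         κ x <L κ y × x ∈ elems × y ∈ elems
  generator-increasing des (zeroStep k l 1≤k l≡1+k) =
    inj₁ (subst (toℕ k <_) (sym l≡1+k) ℕ.≤-refl) , zero∈elems 1≤k ,
    zero∈elems (subst (0 <_) (sym l≡1+k) (s≤s z≤n))
  generator-increasing des (chainStep i i∉I)
    rewrite ⟪⟫-letter (inv σ) π i | ⟪⟫-nextLetter (inv σ) π i
    with suc (toℕ i) <? n | nondescent-increasing des i∉I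
  ... | yes _ | lt = lt , letter∈elems i , letter∈elems _
  ... | no _ | lt = lt , letter∈elems i , zero∈elems (colour-pos lt)
    where
    colour-pos : ∀ {x k} → x <L (k , 0) → 0 < toℕ k
    colour-pos (inj₁ lt) = ℕ.≤-<-trans z≤n lt

  ≺-increasing : DesSubset τ I → ∀ {x y} → TransClosure (ChainGen I π) x y →
                 κ x <L κ y × x ∈ elems × y ∈ elems
  ≺-increasing des [ g ] = generator-increasing des g
  ≺-increasing des (g ∷ gs) with generator-increasing des g | ≺-increasing des gs
  ... | lt₁ , x∈ , _ | lt₂ , _ , z∈ = <L-trans lt₁ lt₂ , x∈ , z∈

  DesSubset⇒CL : DesSubset τ I → InCLP (suc m) n (C I π) (oneLine σ)
  DesSubset⇒CL des = w₀ , (w₀∈G0 , w₀-↭ , w₀-ordered) , σ∈CLw₀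
    where
    w₀-ordered : ∀ x y → TransClosure (ChainGen I π) x y → LeftOf w₀ x y
    w₀-ordered x y x≺y with ≺-increasing des x≺y
    ... | κx<κy , x∈ , y∈ = AllPairs⇒LeftOf <L-asym w₀-sorted
                              (∈-resp-↭ (↭-sym w₀-↭) x∈) (∈-resp-↭ (↭-sym w₀-↭) y∈) κx<κy

mainTheorem11 : (r n : ℕ) .{{_ : NonZero r}} (σ π : ColPerm r n) (I : Subset n) →
    (InCLP r n (C I π) (oneLine σ) → DesSubset (inv σ · π) I)
      × (DesSubset (inv σ · π) I → InCLP r n (C I π) (oneLine σ))
mainTheorem11 zero n σ π I = ⊥-elim (ℕ.n≮0 (>-nonZero⁻¹ 0))
mainTheorem11 (suc m) n σ π I = Necessity.CL⇒DesSubset σ π I , Sufficiency.DesSubset⇒CL σ π I
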